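{- Let $m \geq 4$ and let $n$ be an even positive integer. Then the radio number of the stacked-book graph $G_{m,n}=S_m \Box P_n$ is $$rn(G_{m,n})=\frac{mn^2}{2}+n-1.$$
   Context: $S_m$ denotes the star on $m$ vertices (one center vertex adjacent to $m-1$ leaves) and $P_n$ the path on $n$ vertices. The stacked-book graph $G_{m,n}=S_m \Box P_n$ is their Cartesian product. For a simple connected graph $G$ with distance $d$ and diameter $\mathrm{diam}(G)$, a radio labeling is a function $f:V(G)\to \mathbb{Z}_{\ge 0}$ such that $|f(u)-f(v)|\geq \mathrm{diam}(G)+1-d(u,v)$ for all distinct $u,v\in V(G)$. The span of $f$ is $\max_{v} f(v)-\min_{v} f(v)$. The radio number $rn(G)$ is the minimum span over all radio labelings of $G$. -}

module Defs where

open import Data.Nat using (ℕ; zero; suc; _+_; _∸_; _≤_; _<_)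
open import Data.Nat.Properties using ()
open import Data.Nat using (∣_-_∣)
open import Data.Fin using (Fin; toℕ)
open import Data.Product using (_×_; _,_; ∃; ∃-syntax; Σ)
open import Data.Sum using (_⊎_)
open import Relation.Binary.PropositionalEquality using (_≡_; _≢_)
open import Relation.Nullary using (¬_)
open import Level using (0ℓ)

record Graph : Set₁ where
  field
    V   : Set
    Adj : V → V → Set
open Graph public

data Walk (G : Graph) : V G → V G → ℕ → Set where
  here : ∀ {u} → Walk G u u 0
  step : ∀ {u w v k} → Adj G u w → Walk G w v k → Walk G u v (suc k)

Dist : (G : Graph) → V G → V G → ℕ → Set
Dist G u v k = Walk G u v k × (∀ j → j < k → ¬ Walk G u v j)

IsDiam : (G : Graph) → ℕ → Set
IsDiam G D = (∃[ u ] ∃[ v ] Dist G u v D) × (∀ u v k → Dist G u v k → k ≤ D)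

RadioLabeling : (G : Graph) → (V G → ℕ) → Set
RadioLabeling G f =
  ∀ D → IsDiam G D → ∀ u v → u ≢ v → ∀ k → Dist G u v k → D + 1 ∸ k ≤ ∣ f u - f v ∣

Span : (G : Graph) → (V G → ℕ) → ℕ → Set
Span G f s = (∃[ u ] ∃[ v ] f u ∸ f v ≡ s) × (∀ u v → f u ∸ f v ≤ s)

RadioNumber : Graph → ℕ → Set
RadioNumber G r =
  (∃[ f ] RadioLabeling G f × Span G f r) ×
  (∀ f s → RadioLabeling G f → Span G f s → r ≤ s)

Star : ℕ → Graph
Star m = record
  { V = Fin m
  ; Adj = λ a b → (toℕ a ≡ 0 × toℕ b ≢ 0) ⊎ (toℕ a ≢ 0 × toℕ b ≡ 0) }

Path : ℕ → Graph
Path n = record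
  { V = Fin n
  ; Adj = λ i j → (toℕ j ≡ suc (toℕ i)) ⊎ (toℕ i ≡ suc (toℕ j)) }

_□_ : Graph → Graph → Graph
G □ H = record
  { V = V G × V H
  ; Adj = λ { (a , i) (b , j) → (Adj G a b × i ≡ j) ⊎ (a ≡ b × Adj H i j) } }

StackedBook : ℕ → ℕ → Graph
StackedBook m n = Star m □ Path n

-- Write n = 2h. Distances in S_m □ P_n are sums of the distances in the two factors, so the diameter
-- is n + 1 and a radio labeling must satisfy |f u − f v| ≥ n + 2 − d(u, v).
--
-- Lower bound (Liu's level argument): let L(a, i) be the depth of a in the star plus the distance from
-- i to the central vertices h − 1, h of the path, so that d(u, v) ≤ L(u) + L(v) + 1. Listing the
-- vertices by increasing label, consecutive labels then differ by at least n + 1 − L(u) − L(v), and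
-- summing over the list gives span ≥ (mn − 1)(n + 1) − 2 ΣL = mn²/2 + n − 1.
--
-- Upper bound: visit the vertices in h rounds; round ℓ alternates between the columns h + ℓ and ℓ,
-- taking the star vertices 0, 2, 1, 3, 2, 4, …, m − 1, m − 2, 1, m − 1, 0. The vertex at offset k of
-- round ℓ gets the label (2mℓ + k)h + 3ℓ + [k ≥ 1] + [k ≥ 2m − 1]. Consecutive vertices lie in
-- different halves of the path, hence at distance at least h + 1, and the bonus terms pay exactly for
-- the steps through the centre of the star; vertices two steps apart within a round share a column
-- but not a star vertex; any other two vertices have labels at least 2h + 1 apart, the 3 added per
-- round absorbing the drop of the bonus. The last label is mn²/2 + n − 1.

module Submission where

open import Defs
open import Data.Nat
open import Data.Nat.Properties
open import Data.Nat.DivMod using (m≡m%n+[m/n]*n; m*n/n≡m)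
open import Data.Nat.ListAction using (sum)
open import Data.Nat.ListAction.Properties using (sum-↭; sum-++)
open import Data.Nat.Tactic.RingSolver using (solve-∀)
open import Data.Fin using (Fin; zero; suc; toℕ; fromℕ; fromℕ<; _↑ˡ_; _↑ʳ_; splitAt)
open import Data.Fin.Properties
  using ( toℕ-injective; toℕ<n; toℕ-fromℕ; toℕ-fromℕ<; toℕ-↑ˡ; toℕ-↑ʳ
        ; join-splitAt; splitAt-↑ˡ; splitAt-↑ʳ )
open import Data.Product using (_×_; _,_; proj₁; proj₂; ∃-syntax)
open import Data.Sum using (_⊎_; inj₁; inj₂; [_,_]′)
open import Data.List using (List; []; _∷_; _++_; length; map; tabulate; allFin; cartesianProduct)
open import Data.List.Properties
  using (length-++; length-map; map-++; map-tabulate; length-tabulate; map-cong; map-∘)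
open import Data.List.Relation.Unary.All using (_∷_)
open import Data.List.Relation.Unary.AllPairs using (_∷_)
open import Data.List.Relation.Unary.Linked using (Linked; _∷_)
open import Data.List.Relation.Unary.Unique.Propositional using (Unique)
open import Data.List.Relation.Unary.Unique.Propositional.Properties using (cartesianProduct⁺; allFin⁺)
open import Data.List.Relation.Binary.Permutation.Propositional using (_↭_; ↭-sym; ↭⇒↭ₛ)
open import Data.List.Relation.Binary.Permutation.Propositional.Properties using (↭-length; map⁺)
import Data.List.Relation.Binary.Permutation.Setoid.Properties as Permutationₛ
import Data.List.Sort as Sort
open import Function using (_∘_; id)
open import Relation.Binary.Definitions using (tri<; tri≈; tri>)
import Relation.Binary.Construct.On as On
open import Relation.Binary.PropositionalEquality
open import Relation.Nullary using (yes; no)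
open import Relation.Nullary.Negation using (contradiction)

-- Distance functions of graphs

module _ {G : Graph} where

  _++ʷ_ : ∀ {u w v k l} → Walk G u w k → Walk G w v l → Walk G u v (k + l)
  here     ++ʷ q = q
  step a p ++ʷ q = step a (p ++ʷ q)

  _∷ʳʷ_ : ∀ {u w v k} → Walk G u w k → Adj G w v → Walk G u v (suc k)
  here     ∷ʳʷ b = step b here
  step a p ∷ʳʷ b = step a (p ∷ʳʷ b)

  reverseʷ : (∀ {u v} → Adj G u v → Adj G v u) → ∀ {u v k} → Walk G u v k → Walk G v u k
  reverseʷ sym-adj here       = here
  reverseʷ sym-adj (step a p) = reverseʷ sym-adj p ∷ʳʷ sym-adj a

  walk₀⇒≡ : ∀ {u v} → Walk G u v 0 → u ≡ v
  walk₀⇒≡ here = refl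

  IsDiam-unique : ∀ {D D′} → IsDiam G D → IsDiam G D′ → D ≡ D′
  IsDiam-unique ((u , v , uv) , ≤D) ((u′ , v′ , uv′) , ≤D′) =
    ≤-antisym (≤D′ u v _ uv) (≤D u′ v′ _ uv′)

record IsDistance (G : Graph) (d : V G → V G → ℕ) : Set where
  field
    walk   : ∀ u v → Walk G u v (d u v)
    d-self : ∀ u → d u u ≡ 0
    d-step : ∀ {u w} v → Adj G u w → d u v ≤ suc (d w v)

  d≤length : ∀ {u v k} → Walk G u v k → d u v ≤ k
  d≤length {u} here             = ≤-reflexive (d-self u)
  d≤length {v = v} (step adj p) = ≤-trans (d-step v adj) (s≤s (d≤length p))

  dist : ∀ u v → Dist G u v (d u v)
  dist u v = walk u v , λ j j<d p → <⇒≱ j<d (d≤length p)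

  Dist⇒≡ : ∀ {u v k} → Dist G u v k → k ≡ d u v
  Dist⇒≡ {u} {v} (p , shortest) = ≤-antisym (≮⇒≥ λ d<k → shortest _ d<k (walk u v)) (d≤length p)

  d≡0⇒≡ : ∀ {u v} → d u v ≡ 0 → u ≡ v
  d≡0⇒≡ {u} {v} d≡0 = walk₀⇒≡ (subst (Walk G u v) d≡0 (walk u v))

module _ {G H : Graph} where

  lift-□ˡ : ∀ {a b k} (i : V H) → Walk G a b k → Walk (G □ H) (a , i) (b , i) k
  lift-□ˡ i here       = here
  lift-□ˡ i (step a p) = step (inj₁ (a , refl)) (lift-□ˡ i p)

  lift-□ʳ : ∀ {i j k} (a : V G) → Walk H i j k → Walk (G □ H) (a , i) (a , j) k
  lift-□ʳ a here       = here
  lift-□ʳ a (step b p) = step (inj₂ (refl , b)) (lift-□ʳ a p)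

  productDist : (V G → V G → ℕ) → (V H → V H → ℕ) → V (G □ H) → V (G □ H) → ℕ
  productDist dG dH (a , i) (b , j) = dG a b + dH i j

  □-isDistance : ∀ {dG dH} → IsDistance G dG → IsDistance H dH → IsDistance (G □ H) (productDist dG dH)
  □-isDistance {dG} {dH} isG isH = record
    { walk   = λ { (a , i) (b , j) → lift-□ˡ i (G.walk a b) ++ʷ lift-□ʳ b (H.walk i j) }
    ; d-self = λ { (a , i) → cong₂ _+_ (G.d-self a) (H.d-self i) }
    ; d-step = step-≤
    }
    where
    module G = IsDistance isG
    module H = IsDistance isH
    step-≤ : ∀ {u w} v → Adj (G □ H) u w → productDist dG dH u v ≤ suc (productDist dG dH w v)
    step-≤ (c , k) (inj₁ (adj , refl)) = +-monoˡ-≤ _ (G.d-step c adj)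
    step-≤ {a , _} (c , k) (inj₂ (refl , adj)) =
      ≤-trans (+-monoʳ-≤ (dG a c) (H.d-step k adj)) (≤-reflexive (+-suc _ _))

-- The star, the path and the stacked book

depth : ℕ → ℕ
depth zero    = 0
depth (suc _) = 1

starDist : ℕ → ℕ → ℕ
starDist a b with a ≟ b
... | yes _ = 0
... | no  _ = depth a + depth b

depth≤1 : ∀ a → depth a ≤ 1
depth≤1 zero    = z≤n
depth≤1 (suc _) = ≤-refl

starDist-self : ∀ a → starDist a a ≡ 0
starDist-self a with a ≟ a
... | yes _   = refl
... | no  a≢a = contradiction refl a≢a

starDist-≢ : ∀ {a b} → a ≢ b → starDist a b ≡ depth a + depth b
starDist-≢ {a} {b} a≢b with a ≟ b
... | yes a≡b = contradiction a≡b a≢b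
... | no  _   = refl

starDist≤depth+depth : ∀ a b → starDist a b ≤ depth a + depth b
starDist≤depth+depth a b with a ≟ b
... | yes _ = z≤n
... | no  _ = ≤-refl

starDist-center : ∀ b → starDist 0 b ≡ depth b
starDist-center zero    = refl
starDist-center (suc b) = refl

starDist-comm : ∀ a b → starDist a b ≡ starDist b a
starDist-comm a b with a ≟ b | b ≟ a
... | yes _   | yes _   = refl
... | no  _   | no  _   = +-comm (depth a) (depth b)
... | yes a≡b | no  b≢a = contradiction (sym a≡b) b≢a
... | no  a≢b | yes b≡a = contradiction (sym b≡a) a≢b

starDist≤2 : ∀ a b → starDist a b ≤ 2
starDist≤2 a b = ≤-trans (starDist≤depth+depth a b) (+-mono-≤ (depth≤1 a) (depth≤1 b))

module _ {M : ℕ} where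

  toCenter : (a : Fin (suc M)) → Walk (Star (suc M)) a zero (depth (toℕ a))
  toCenter zero    = here
  toCenter (suc a) = step (inj₂ ((λ ()) , refl)) here

  fromCenter : (b : Fin (suc M)) → Walk (Star (suc M)) zero b (depth (toℕ b))
  fromCenter zero    = here
  fromCenter (suc b) = step (inj₁ (refl , (λ ()))) here

  star-isDistance : IsDistance (Star (suc M)) (λ a b → starDist (toℕ a) (toℕ b))
  star-isDistance = record
    { walk   = walk
    ; d-self = λ a → starDist-self (toℕ a)
    ; d-step = d-step
    }
    where
    walk : ∀ a b → Walk (Star (suc M)) a b (starDist (toℕ a) (toℕ b))
    walk a b with toℕ a ≟ toℕ b
    ... | yes a≡b = subst (λ c → Walk _ a c 0) (toℕ-injective a≡b) here
    ... | no  _   = toCenter a ++ʷ fromCenter b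
    d-step : ∀ {a w} b → Adj (Star (suc M)) a w →
             starDist (toℕ a) (toℕ b) ≤ suc (starDist (toℕ w) (toℕ b))
    d-step b (inj₁ (a≡0 , _)) rewrite a≡0 =
      ≤-trans (≤-reflexive (starDist-center (toℕ b))) (≤-trans (depth≤1 (toℕ b)) (s≤s z≤n))
    d-step {a} b (inj₂ (_ , w≡0)) rewrite w≡0 =
      ≤-trans (starDist≤depth+depth (toℕ a) (toℕ b))
              (+-mono-≤ (depth≤1 (toℕ a)) (≤-reflexive (sym (starDist-center (toℕ b)))))

∣n-1+n∣≡1 : ∀ n → ∣ n - suc n ∣ ≡ 1
∣n-1+n∣≡1 n = trans (cong (λ k → ∣ n - k ∣) (+-comm 1 n)) (∣m-m+n∣≡n n 1)

module _ {n : ℕ} where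

  path-adj-sym : ∀ {i j} → Adj (Path n) i j → Adj (Path n) j i
  path-adj-sym (inj₁ e) = inj₂ e
  path-adj-sym (inj₂ e) = inj₁ e

  path-adj-∣-∣ : ∀ {i j} → Adj (Path n) i j → ∣ toℕ i - toℕ j ∣ ≡ 1
  path-adj-∣-∣ {i} (inj₁ j≡1+i) rewrite j≡1+i = ∣n-1+n∣≡1 (toℕ i)
  path-adj-∣-∣ {i} {j} (inj₂ i≡1+j) rewrite i≡1+j =
    trans (∣-∣-comm (suc (toℕ j)) (toℕ j)) (∣n-1+n∣≡1 (toℕ j))

  ascending : ∀ k (i j : Fin n) → toℕ i + k ≡ toℕ j → Walk (Path n) i j k
  ascending zero i j i+0≡j =
    subst (λ c → Walk _ i c 0) (toℕ-injective (trans (sym (+-identityʳ _)) i+0≡j)) here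
  ascending (suc k) i j i+1+k≡j = step (inj₁ (toℕ-fromℕ< i+1<n)) (ascending k _ j next+k≡j)
    where
    1+i+k≡j : suc (toℕ i + k) ≡ toℕ j
    1+i+k≡j = trans (sym (+-suc (toℕ i) k)) i+1+k≡j
    i+1<n : suc (toℕ i) < n
    i+1<n = ≤-<-trans (≤-trans (s≤s (m≤m+n (toℕ i) k)) (≤-reflexive 1+i+k≡j)) (toℕ<n j)
    next+k≡j : toℕ (fromℕ< i+1<n) + k ≡ toℕ j
    next+k≡j = trans (cong (_+ k) (toℕ-fromℕ< i+1<n)) 1+i+k≡j

  path-isDistance : IsDistance (Path n) (λ i j → ∣ toℕ i - toℕ j ∣)
  path-isDistance = record
    { walk   = walk
    ; d-self = λ i → ∣n-n∣≡0 (toℕ i)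
    ; d-step = λ {i} {w} v i~w → ≤-trans (∣-∣-triangle (toℕ i) (toℕ w) (toℕ v))
                                         (≤-reflexive (cong (_+ ∣ toℕ w - toℕ v ∣) (path-adj-∣-∣ i~w)))
    }
    where
    walk : ∀ i j → Walk (Path n) i j ∣ toℕ i - toℕ j ∣
    walk i j with ≤-total (toℕ i) (toℕ j)
    ... | inj₁ i≤j rewrite m≤n⇒∣m-n∣≡n∸m i≤j = ascending _ i j (m+[n∸m]≡n i≤j)
    ... | inj₂ j≤i rewrite m≤n⇒∣n-m∣≡n∸m j≤i =
      reverseʷ path-adj-sym (ascending _ j i (m+[n∸m]≡n j≤i))

bookDist : ∀ {m n} → V (StackedBook m n) → V (StackedBook m n) → ℕ
bookDist {m} {n} =
  productDist {Star m} {Path n} (λ a b → starDist (toℕ a) (toℕ b)) (λ i j → ∣ toℕ i - toℕ j ∣)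

book-isDistance : ∀ {M n} → IsDistance (StackedBook (suc M) n) bookDist
book-isDistance = □-isDistance star-isDistance path-isDistance

bookDist-comm : ∀ {m n} (u v : V (StackedBook m n)) → bookDist u v ≡ bookDist v u
bookDist-comm (a , i) (b , j) =
  cong₂ _+_ (starDist-comm (toℕ a) (toℕ b)) (∣-∣-comm (toℕ i) (toℕ j))

book-diam : ∀ {M n} → IsDiam (StackedBook (3 + M) (suc n)) (2 + n)
book-diam {M} {n} = (u , v , subst (Dist _ u v) uv≡2+n (dist u v)) ,
                    λ u v k uv≡k → subst (_≤ 2 + n) (sym (Dist⇒≡ uv≡k)) (bookDist≤2+n u v)
  where
  open IsDistance (book-isDistance {2 + M} {suc n})
  u v : V (StackedBook (3 + M) (suc n))
  u = suc zero , zero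
  v = suc (suc zero) , fromℕ n
  uv≡2+n : bookDist u v ≡ 2 + n
  uv≡2+n = cong (2 +_) (toℕ-fromℕ n)
  bookDist≤2+n : ∀ u v → bookDist u v ≤ 2 + n
  bookDist≤2+n (a , i) (b , j) = +-mono-≤ (starDist≤2 (toℕ a) (toℕ b))
    (≤-trans (∣m-n∣≤m⊔n (toℕ i) (toℕ j)) (⊔-lub (s≤s⁻¹ (toℕ<n i)) (s≤s⁻¹ (toℕ<n j))))

-- Radio labelings and Liu's lower bound

∣m-n∣≤o : ∀ {m n o} → m ≤ n + o → n ≤ m + o → ∣ m - n ∣ ≤ o
∣m-n∣≤o {m} {n} m≤n+o n≤m+o with ∣m-n∣≡[m∸n]∨[n∸m] m n
... | inj₁ ∣m-n∣≡m∸n rewrite ∣m-n∣≡m∸n = m≤n+o⇒m∸n≤o m n m≤n+o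
... | inj₂ ∣m-n∣≡n∸m rewrite ∣m-n∣≡n∸m = m≤n+o⇒m∸n≤o n m n≤m+o

m+n≤o+p⇒n∸p≤∣m-o∣ : ∀ {m n o p} → m + n ≤ o + p → n ∸ p ≤ ∣ m - o ∣
m+n≤o+p⇒n∸p≤∣m-o∣ {m} {n} {o} {p} m+n≤o+p =
  ≤-trans (m≤n+o⇒m∸n≤o n p (+-cancelˡ-≤ m _ _ (begin
    m + n              ≤⟨ m+n≤o+p ⟩
    o + p              ≤⟨ +-monoˡ-≤ p (m≤n+m∸n o m) ⟩
    m + (o ∸ m) + p    ≡⟨ rearrange m (o ∸ m) p ⟩
    m + (p + (o ∸ m))  ∎)))
  (≤-trans (m∸n≤∣m-n∣ o m) (≤-reflexive (∣-∣-comm o m)))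
  where
  open ≤-Reasoning
  rearrange : ∀ a b c → a + b + c ≡ a + (c + b)
  rearrange = solve-∀

m≤o⇒n∸p≤∣m-o∣⇒m+n≤o+p : ∀ {m n o p} → m ≤ o → n ∸ p ≤ ∣ m - o ∣ → m + n ≤ o + p
m≤o⇒n∸p≤∣m-o∣⇒m+n≤o+p {m} {n} {o} {p} m≤o n∸p≤∣m-o∣ = begin
  m + n              ≤⟨ +-monoʳ-≤ m (m≤n+m∸n n p) ⟩
  m + (p + (n ∸ p))  ≤⟨ +-monoʳ-≤ m (+-monoʳ-≤ p n∸p≤o∸m) ⟩
  m + (p + (o ∸ m))  ≡⟨ swap m p (o ∸ m) ⟩
  p + (m + (o ∸ m))  ≡⟨ cong (p +_) (m+[n∸m]≡n m≤o) ⟩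
  p + o              ≡⟨ +-comm p o ⟩
  o + p              ∎
  where
  open ≤-Reasoning
  n∸p≤o∸m : n ∸ p ≤ o ∸ m
  n∸p≤o∸m = ≤-trans n∸p≤∣m-o∣ (≤-reflexive (m≤n⇒∣m-n∣≡n∸m m≤o))
  swap : ∀ a b c → a + (b + c) ≡ b + (a + c)
  swap = solve-∀

+-≤-exchange : ∀ {a b t t′ k d} → a + t ≤ b + t′ → k + t′ ≤ t + d → a + k ≤ b + d
+-≤-exchange {a} {b} {t} {t′} {k} {d} a+t≤b+t′ k+t′≤t+d = +-cancelʳ-≤ (t + t′) _ _ (begin
  a + k + (t + t′)    ≡⟨ swap a k t t′ ⟩
  (a + t) + (k + t′)  ≤⟨ +-mono-≤ a+t≤b+t′ k+t′≤t+d ⟩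
  (b + t′) + (t + d)  ≡⟨ swap′ b t′ t d ⟩
  b + d + (t + t′)    ∎)
  where
  open ≤-Reasoning
  swap : ∀ a k t t′ → a + k + (t + t′) ≡ a + t + (k + t′)
  swap = solve-∀
  swap′ : ∀ b t′ t d → b + t′ + (t + d) ≡ b + d + (t + t′)
  swap′ = solve-∀

module _ {G : Graph} {d : V G → V G → ℕ} (isDist : IsDistance G d) {D : ℕ} (diam : IsDiam G D) where

  radioLabeling-intro : ∀ f → (∀ u v → u ≢ v → D + 1 ∸ d u v ≤ ∣ f u - f v ∣) → RadioLabeling G f
  radioLabeling-intro f spaced D′ diam′ u v u≢v k uv≡k
    rewrite IsDiam-unique diam′ diam | IsDistance.Dist⇒≡ isDist uv≡k = spaced u v u≢v

module _ {A : Set} (f : A → ℕ) (D : ℕ) (w : A → ℕ)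
         (gap : ∀ u v → u ≢ v → f u ≤ f v → f u + D ≤ f v + (w u + w v)) where

  sorted-chain : ∀ {M} → (∀ y → f y ≤ M) → ∀ x xs →
                 Linked (λ u v → f u ≤ f v) (x ∷ xs) → Unique (x ∷ xs) →
                 f x + length xs * D + w x ≤ M + 2 * sum (map w (x ∷ xs))
  sorted-chain {M} ≤M x [] _ _ = begin
    f x + 0 + w x        ≤⟨ +-mono-≤ (+-monoˡ-≤ 0 (≤M x)) (m≤n+m (w x) (w x)) ⟩
    M + 0 + (w x + w x)  ≡⟨ rearrange M (w x) ⟩
    M + 2 * (w x + 0)    ∎
    where
    open ≤-Reasoning
    rearrange : ∀ M a → M + 0 + (a + a) ≡ M + 2 * (a + 0)
    rearrange = solve-∀
  sorted-chain {M} ≤M x (y ∷ ys) (fx≤fy ∷ sorted) ((x≢y ∷ _) ∷ unique) =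
    +-cancelʳ-≤ (f y + w y) _ _ (begin
      f x + length (y ∷ ys) * D + w x + (f y + w y)
        ≡⟨ split (f x) (f y) D (length ys) (w x) (w y) ⟩
      f x + D + (f y + length ys * D + w y) + w x
        ≤⟨ +-monoˡ-≤ (w x) (+-mono-≤ (gap x y x≢y fx≤fy) (sorted-chain ≤M y ys sorted unique)) ⟩
      f y + (w x + w y) + (M + 2 * (w y + Σ)) + w x
        ≡⟨ merge (f y) (w x) (w y) M Σ ⟩
      M + 2 * (w x + (w y + Σ)) + (f y + w y) ∎)
    where
    open ≤-Reasoning
    Σ : ℕ
    Σ = sum (map w ys)
    split : ∀ a b D k c e → a + suc k * D + c + (b + e) ≡ a + D + (b + k * D + e) + c
    split = solve-∀
    merge : ∀ b c e M S → b + (c + e) + (M + 2 * (e + S)) + c ≡ M + 2 * (c + (e + S)) + (b + e)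
    merge = solve-∀

  span-lower-bound : ∀ {s} → (∀ u v → f u ∸ f v ≤ s) → ∀ vs → Unique vs →
                     (length vs ∸ 1) * D ≤ s + 2 * sum (map w vs)
  span-lower-bound {s} span vs unique with sort vs | sort-↭ vs | sort-↗ vs
    where open Sort (On.decTotalOrder ≤-decTotalOrder f)
  ... | []     | ws↭vs | _      rewrite sym (↭-length ws↭vs) = z≤n
  ... | x ∷ xs | ws↭vs | sorted rewrite sym (↭-length ws↭vs) | sym (sum-↭ (map⁺ w ws↭vs)) =
    +-cancelˡ-≤ (f x) _ _ (begin
      f x + length xs * D                   ≤⟨ m≤m+n _ (w x) ⟩
      f x + length xs * D + w x             ≤⟨ sorted-chain ≤fx+s x xs sorted unique′ ⟩
      f x + s + 2 * sum (map w (x ∷ xs))    ≡⟨ +-assoc (f x) s _ ⟩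
      f x + (s + 2 * sum (map w (x ∷ xs)))  ∎)
    where
    open ≤-Reasoning
    ≤fx+s : ∀ y → f y ≤ f x + s
    ≤fx+s y = ≤-trans (m≤n+m∸n (f y) (f x)) (+-monoʳ-≤ (f x) (span y x))
    unique′ : Unique (x ∷ xs)
    unique′ = Permutationₛ.Unique-resp-↭ (setoid A) (↭⇒↭ₛ (↭-sym ws↭vs)) unique

sum-map-+ : ∀ {A : Set} (f g : A → ℕ) xs →
            sum (map (λ x → f x + g x) xs) ≡ sum (map f xs) + sum (map g xs)
sum-map-+ f g []       = refl
sum-map-+ f g (x ∷ xs) = trans (cong (f x + g x +_) (sum-map-+ f g xs)) (swap (f x) (g x) _ _)
  where
  swap : ∀ a b c d → a + b + (c + d) ≡ a + c + (b + d)
  swap = solve-∀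

sum-map-const : ∀ {A : Set} c (xs : List A) → sum (map (λ _ → c) xs) ≡ length xs * c
sum-map-const c []       = refl
sum-map-const c (x ∷ xs) = cong (c +_) (sum-map-const c xs)

sum-map-++ : ∀ {A : Set} (f : A → ℕ) xs ys → sum (map f (xs ++ ys)) ≡ sum (map f xs) + sum (map f ys)
sum-map-++ f xs ys = trans (cong sum (map-++ f xs ys)) (sum-++ (map f xs) (map f ys))

sum-map-cartesianProduct : ∀ {A B : Set} (f : A → ℕ) (g : B → ℕ) xs ys →
  sum (map (λ p → f (proj₁ p) + g (proj₂ p)) (cartesianProduct xs ys)) ≡
  length ys * sum (map f xs) + length xs * sum (map g ys)
sum-map-cartesianProduct f g [] ys = sym (trans (+-identityʳ _) (*-zeroʳ (length ys)))
sum-map-cartesianProduct {A} {B} f g (x ∷ xs) ys = begin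
  sum (map F (map (x ,_) ys ++ cartesianProduct xs ys))
    ≡⟨ sum-map-++ F (map (x ,_) ys) _ ⟩
  sum (map F (map (x ,_) ys)) + sum (map F (cartesianProduct xs ys))
    ≡⟨ cong₂ _+_ (cong sum (sym (map-∘ ys))) (sum-map-cartesianProduct f g xs ys) ⟩
  sum (map (λ y → f x + g y) ys) + rest
    ≡⟨ cong (_+ rest) (sum-map-+ (λ _ → f x) g ys) ⟩
  sum (map (λ _ → f x) ys) + Σg + rest
    ≡⟨ cong (λ t → t + Σg + rest) (sum-map-const (f x) ys) ⟩
  length ys * f x + Σg + (length ys * Σf + length xs * Σg)
    ≡⟨ regroup (length ys) (length xs) (f x) Σf Σg ⟩
  length ys * (f x + Σf) + suc (length xs) * Σg ∎
  where
  open ≡-Reasoning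
  F : A × B → ℕ
  F p = f (proj₁ p) + g (proj₂ p)
  Σf Σg rest : ℕ
  Σf = sum (map f xs)
  Σg = sum (map g ys)
  rest = length ys * Σf + length xs * Σg
  regroup : ∀ k l a s t → k * a + t + (k * s + l * t) ≡ k * (a + s) + suc l * t
  regroup = solve-∀

length-cartesianProduct : ∀ {A B : Set} (xs : List A) (ys : List B) →
                          length (cartesianProduct xs ys) ≡ length xs * length ys
length-cartesianProduct []       ys = refl
length-cartesianProduct (x ∷ xs) ys =
  trans (length-++ (map (x ,_) ys)) (cong₂ _+_ (length-map (x ,_) ys) (length-cartesianProduct xs ys))

tabulate-+ : ∀ {A : Set} m {n} (f : Fin (m + n) → A) →
             tabulate f ≡ tabulate (f ∘ (_↑ˡ n)) ++ tabulate (f ∘ (m ↑ʳ_))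
tabulate-+ zero    f = refl
tabulate-+ (suc m) f = cong (f zero ∷_) (tabulate-+ m (f ∘ suc))

-- distance from i to the nearer of the two central vertices g and g + 1 of the path on 2g + 2 vertices
centralDist : ℕ → ℕ → ℕ
centralDist g i = (g ∸ i) + (i ∸ suc g)

∣i-j∣≤1+centralDist : ∀ g i j → ∣ i - j ∣ ≤ suc (centralDist g i + centralDist g j)
∣i-j∣≤1+centralDist g i j = ∣m-n∣≤o (below i j)
  (≤-trans (below j i) (≤-reflexive (cong (λ k → i + suc k) (+-comm (centralDist g j) _))))
  where
  open ≤-Reasoning
  below : ∀ i j → i ≤ j + suc (centralDist g i + centralDist g j)
  below i j = begin
    i                                  ≤⟨ m≤n+m∸n i (suc g) ⟩
    suc g + (i ∸ suc g)                ≤⟨ +-monoˡ-≤ (i ∸ suc g) (s≤s (m≤n+m∸n g j)) ⟩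
    suc (j + (g ∸ j)) + (i ∸ suc g)    ≡⟨ regroup j (g ∸ j) (i ∸ suc g) ⟩
    j + suc ((i ∸ suc g) + (g ∸ j))
      ≤⟨ +-monoʳ-≤ j (s≤s (+-mono-≤ (m≤n+m _ (g ∸ i)) (m≤m+n (g ∸ j) _))) ⟩
    j + suc (centralDist g i + centralDist g j) ∎
    where
    regroup : ∀ j a b → suc (j + a) + b ≡ j + suc (b + a)
    regroup = solve-∀

centralDist-pair : ∀ g ℓ → ℓ ≤ g → centralDist g ℓ + centralDist g (suc g + ℓ) ≡ g
centralDist-pair g ℓ ℓ≤g = begin
  (g ∸ ℓ) + (ℓ ∸ suc g) + ((g ∸ (suc g + ℓ)) + (suc g + ℓ ∸ suc g))
    ≡⟨ cong₂ (λ a b → (g ∸ ℓ) + a + (b + (suc g + ℓ ∸ suc g)))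
             (m≤n⇒m∸n≡0 (m≤n⇒m≤1+n ℓ≤g)) (m≤n⇒m∸n≡0 (m≤n⇒m≤1+n (m≤m+n g ℓ))) ⟩
  (g ∸ ℓ) + 0 + (0 + (suc g + ℓ ∸ suc g))
    ≡⟨ cong₂ _+_ (+-identityʳ (g ∸ ℓ)) (m+n∸m≡n (suc g) ℓ) ⟩
  (g ∸ ℓ) + ℓ
    ≡⟨ m∸n+n≡m ℓ≤g ⟩
  g ∎
  where open ≡-Reasoning

-- the value m n² / 2 + n − 1 of the theorem for n = 2 (g + 1)
rnValue : ℕ → ℕ → ℕ
rnValue m g = 2 * m * suc g * suc g + (g + suc g)

module LowerBound (M g : ℕ) where

  private
    m h : ℕ
    m = 3 + M
    h = suc g
    G : Graph
    G = StackedBook m (h + h)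
    open IsDistance (book-isDistance {2 + M} {h + h})

  bookLevel : V G → ℕ
  bookLevel (a , i) = depth (toℕ a) + centralDist g (toℕ i)

  bookDist≤1+levels : ∀ u v → bookDist u v ≤ suc (bookLevel u + bookLevel v)
  bookDist≤1+levels (a , i) (b , j) = begin
    starDist (toℕ a) (toℕ b) + ∣ toℕ i - toℕ j ∣
      ≤⟨ +-mono-≤ (starDist≤depth+depth (toℕ a) (toℕ b)) (∣i-j∣≤1+centralDist g (toℕ i) (toℕ j)) ⟩
    depth (toℕ a) + depth (toℕ b) + suc (centralDist g (toℕ i) + centralDist g (toℕ j))
      ≡⟨ regroup (depth (toℕ a)) (depth (toℕ b)) _ _ ⟩
    suc (bookLevel (a , i) + bookLevel (b , j)) ∎
    where
    open ≤-Reasoning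
    regroup : ∀ a b c d → a + b + suc (c + d) ≡ suc (a + c + (b + d))
    regroup = solve-∀

  vertices : List (V G)
  vertices = cartesianProduct (allFin m) (allFin (h + h))

  length-vertices : length vertices ≡ m * (h + h)
  length-vertices = trans (length-cartesianProduct (allFin m) (allFin (h + h)))
    (cong₂ _*_ (length-tabulate {n = m} id) (length-tabulate {n = h + h} id))

  sum-depth : sum (map (depth ∘ toℕ) (allFin m)) ≡ 2 + M
  sum-depth = begin
    sum (map (depth ∘ toℕ) (tabulate {n = 2 + M} suc))
      ≡⟨ cong sum (trans (map-tabulate suc (depth ∘ toℕ)) (sym (map-tabulate {n = 2 + M} id (λ _ → 1)))) ⟩
    sum (map (λ _ → 1) (allFin (2 + M)))
      ≡⟨ sum-map-const 1 (allFin (2 + M)) ⟩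
    length (allFin (2 + M)) * 1
      ≡⟨ trans (cong (_* 1) (length-tabulate {n = 2 + M} id)) (*-identityʳ (2 + M)) ⟩
    2 + M ∎
    where open ≡-Reasoning

  sum-centralDist : sum (map (centralDist g ∘ toℕ) (allFin (h + h))) ≡ h * g
  sum-centralDist = begin
    sum (map c (allFin (h + h)))
      ≡⟨ cong (sum ∘ map c) (tabulate-+ h {h} id) ⟩
    sum (map c (tabulate lower ++ tabulate upper))
      ≡⟨ sum-map-++ c (tabulate lower) _ ⟩
    sum (map c (tabulate lower)) + sum (map c (tabulate upper))
      ≡⟨ cong₂ _+_ (cong sum (map-allFin lower)) (cong sum (map-allFin upper)) ⟩
    sum (map (c ∘ lower) (allFin h)) + sum (map (c ∘ upper) (allFin h))
      ≡⟨ sym (sum-map-+ (c ∘ lower) (c ∘ upper) (allFin h)) ⟩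
    sum (map (λ ℓ → c (lower ℓ) + c (upper ℓ)) (allFin h))
      ≡⟨ cong sum (map-cong pair (allFin h)) ⟩
    sum (map (λ _ → g) (allFin h))
      ≡⟨ trans (sum-map-const g (allFin h)) (cong (_* g) (length-tabulate {n = h} id)) ⟩
    h * g ∎
    where
    open ≡-Reasoning
    c : Fin (h + h) → ℕ
    c = centralDist g ∘ toℕ
    lower upper : Fin h → Fin (h + h)
    lower ℓ = ℓ ↑ˡ h
    upper ℓ = h ↑ʳ ℓ
    map-allFin : (k : Fin h → Fin (h + h)) → map c (tabulate k) ≡ map (c ∘ k) (allFin h)
    map-allFin k = trans (map-tabulate k c) (sym (map-tabulate id (c ∘ k)))
    pair : ∀ ℓ → c (lower ℓ) + c (upper ℓ) ≡ g
    pair ℓ = begin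
      centralDist g (toℕ (ℓ ↑ˡ h)) + centralDist g (toℕ (h ↑ʳ ℓ))
        ≡⟨ cong₂ (λ i j → centralDist g i + centralDist g j) (toℕ-↑ˡ ℓ h) (toℕ-↑ʳ h ℓ) ⟩
      centralDist g (toℕ ℓ) + centralDist g (h + toℕ ℓ)
        ≡⟨ centralDist-pair g (toℕ ℓ) (s≤s⁻¹ (toℕ<n ℓ)) ⟩
      g ∎

  sum-bookLevel : sum (map bookLevel vertices) ≡ (h + h) * (2 + M) + m * (h * g)
  sum-bookLevel = begin
    sum (map bookLevel vertices)
      ≡⟨ sum-map-cartesianProduct (depth ∘ toℕ) (centralDist g ∘ toℕ) (allFin m) (allFin (h + h)) ⟩
    length (allFin (h + h)) * sum (map (depth ∘ toℕ) (allFin m)) +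
    length (allFin m) * sum (map (centralDist g ∘ toℕ) (allFin (h + h)))
      ≡⟨ cong₂ _+_ (cong₂ _*_ (length-tabulate {n = h + h} id) sum-depth)
                   (cong₂ _*_ (length-tabulate {n = m} id) sum-centralDist) ⟩
    (h + h) * (2 + M) + m * (h * g) ∎
    where open ≡-Reasoning

  rnValue≤span : ∀ f s → RadioLabeling G f → Span G f s → rnValue m g ≤ s
  rnValue≤span f s radio (_ , span) = +-cancelʳ-≤ (2 * sum (map bookLevel vertices)) _ _ (begin
    rnValue m g + 2 * sum (map bookLevel vertices)
      ≡⟨ cong (λ t → rnValue m g + 2 * t) sum-bookLevel ⟩
    rnValue m g + 2 * ((h + h) * (2 + M) + m * (h * g))
      ≡⟨ identity M g ⟩
    (m * (h + h) ∸ 1) * D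
      ≡⟨ cong (λ k → (k ∸ 1) * D) (sym length-vertices) ⟩
    (length vertices ∸ 1) * D
      ≤⟨ span-lower-bound f D bookLevel gap span vertices (cartesianProduct⁺ (allFin⁺ m) (allFin⁺ _)) ⟩
    s + 2 * sum (map bookLevel vertices) ∎)
    where
    open ≤-Reasoning
    D : ℕ
    D = 2 + (g + h)
    gap : ∀ u v → u ≢ v → f u ≤ f v → f u + D ≤ f v + (bookLevel u + bookLevel v)
    gap u v u≢v fu≤fv = +-cancelʳ-≤ 1 _ _ (begin
      f u + D + 1                            ≡⟨ +-assoc (f u) D 1 ⟩
      f u + (D + 1)                          ≤⟨ m≤o⇒n∸p≤∣m-o∣⇒m+n≤o+p fu≤fv radio-uv ⟩
      f v + bookDist u v                     ≤⟨ +-monoʳ-≤ (f v) (bookDist≤1+levels u v) ⟩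
      f v + suc (bookLevel u + bookLevel v)  ≡⟨ trans (+-suc (f v) _) (+-comm 1 _) ⟩
      f v + (bookLevel u + bookLevel v) + 1  ∎)
      where
      radio-uv : D + 1 ∸ bookDist u v ≤ ∣ f u - f v ∣
      radio-uv = radio D book-diam u v u≢v _ (dist u v)
    identity : ∀ M g →
      2 * (3 + M) * suc g * suc g + (g + suc g) + 2 * ((suc g + suc g) * (2 + M) + (3 + M) * (suc g * g)) ≡
      (g + suc g + (2 + M) * (suc g + suc g)) * (2 + (g + suc g))
    identity = solve-∀

-- The labeling

data Half : Set where
  lower upper : Half

record Coord : Set where
  constructor ⟨_,_,_⟩
  field
    star  : ℕ
    half  : Half
    round : ℕ
open Coord

offsetOf : Half → ℕ → ℕ
offsetOf upper k = 2 * k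
offsetOf lower k = suc (2 * k)

offsetOf-injective : ∀ {s s′ k k′} → offsetOf s k ≡ offsetOf s′ k′ → s ≡ s′ × k ≡ k′
offsetOf-injective {upper} {upper} {k} {k′} e = refl , *-cancelˡ-≡ k k′ 2 e
offsetOf-injective {lower} {lower} {k} {k′} e = refl , *-cancelˡ-≡ k k′ 2 (suc-injective e)
offsetOf-injective {upper} {lower} {k} {k′} e = contradiction e (even≢odd k k′)
offsetOf-injective {lower} {upper} {k} {k′} e = contradiction (sym e) (even≢odd k′ k)

offsetOf-suc : ∀ s k → offsetOf s (suc k) ≡ suc (suc (offsetOf s k))
offsetOf-suc upper k = *-suc 2 k
offsetOf-suc lower k = cong suc (*-suc 2 k)

offsetOf-adjacent : ∀ {s s′ k k′} → suc (offsetOf s k) ≡ offsetOf s′ k′ →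
                    (s ≡ upper × s′ ≡ lower × k′ ≡ k) ⊎ (s ≡ lower × s′ ≡ upper × k′ ≡ suc k)
offsetOf-adjacent {upper} {s′} {k} {k′} e with offsetOf-injective {lower} {s′} {k} {k′} e
... | refl , refl = inj₁ (refl , refl , refl)
offsetOf-adjacent {lower} {s′} {k} {k′} e
  with offsetOf-injective {upper} {s′} {suc k} {k′} (trans (offsetOf-suc upper k) e)
... | refl , refl = inj₂ (refl , refl , refl)

offsetOf-twoApart : ∀ {s s′ k k′} → suc (suc (offsetOf s k)) ≡ offsetOf s′ k′ →
                    s′ ≡ s × k′ ≡ suc k
offsetOf-twoApart {s} {s′} {k} {k′} e
  with offsetOf-injective {s} {s′} {suc k} {k′} (trans (offsetOf-suc s k) e)
... | refl , refl = refl , refl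

module UpperBound (r g : ℕ) where

  m h q : ℕ
  m = 4 + r
  h = suc g
  q = 2 * m

  -- Within a round the lower-half vertex over a comes right after the upper-half vertex over
  -- lowerRank a, so the star vertices are visited in the order 0, 2, 1, 3, 2, 4, …, m − 2, 1, m − 1, 0.
  lowerRank : ℕ → ℕ
  lowerRank 0             = 3 + r
  lowerRank 1             = 2 + r
  lowerRank (suc (suc a)) = a

  lowerRank<m : ∀ {a} → a < m → lowerRank a < m
  lowerRank<m {0}           _   = ≤-refl
  lowerRank<m {1}           _   = n≤1+n (3 + r)
  lowerRank<m {suc (suc a)} a<m = ≤-trans (m≤n+m (suc a) 2) a<m

  leafRank<2+r : ∀ {a} → 2 + a < m → a < 2 + r
  leafRank<2+r a<m = s≤s⁻¹ (s≤s⁻¹ a<m)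

  leafRank<3+r : ∀ {a} → suc a < m → lowerRank (suc a) < 3 + r
  leafRank<3+r {zero}  _   = ≤-refl
  leafRank<3+r {suc a} a<m = m≤n⇒m≤1+n (leafRank<2+r a<m)

  lowerRank-injective : ∀ {a b} → a < m → b < m → lowerRank a ≡ lowerRank b → a ≡ b
  lowerRank-injective {0}           {0}           _   _   _ = refl
  lowerRank-injective {1}           {1}           _   _   _ = refl
  lowerRank-injective {suc (suc a)} {suc (suc b)} _   _   e = cong (2 +_) e
  lowerRank-injective {0}           {1}           _   _   e = contradiction e 1+n≢n
  lowerRank-injective {1}           {0}           _   _   e = contradiction (sym e) 1+n≢n
  lowerRank-injective {0}           {suc (suc b)} _   b<m e =
    contradiction (n≤1+n (2 + r)) (<⇒≱ (subst (_< 2 + r) (sym e) (leafRank<2+r b<m)))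
  lowerRank-injective {suc (suc a)} {0}           a<m _   e =
    contradiction (n≤1+n (2 + r)) (<⇒≱ (subst (_< 2 + r) e (leafRank<2+r a<m)))
  lowerRank-injective {1}           {suc (suc b)} _   b<m e =
    contradiction (leafRank<2+r b<m) (<-irrefl (sym e))
  lowerRank-injective {suc (suc a)} {1}           a<m _   e =
    contradiction (leafRank<2+r a<m) (<-irrefl e)

  lowerRank-≢ : ∀ a → lowerRank a ≢ a
  lowerRank-≢ 0             ()
  lowerRank-≢ 1             ()
  lowerRank-≢ (suc (suc a)) e = <-irrefl e (s≤s (n≤1+n a))

  rank : Half → ℕ → ℕ
  rank upper a = a
  rank lower a = lowerRank a

  offset : Coord → ℕ
  offset ⟨ a , s , ℓ ⟩ = offsetOf s (rank s a)

  position : Coord → ℕ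
  position x = q * round x + offset x

  -- bonus o = [o ≥ 1] + [o ≥ q − 1]
  bonus : ℕ → ℕ
  bonus o = 1 ⊓ o + 1 ⊓ (o ∸ 2 * (3 + r))

  extra : Coord → ℕ
  extra x = 3 * round x + bonus (offset x)

  label : Coord → ℕ
  label x = position x * h + extra x

  column : Coord → ℕ
  column ⟨ a , lower , ℓ ⟩ = ℓ
  column ⟨ a , upper , ℓ ⟩ = h + ℓ

  coordDist : Coord → Coord → ℕ
  coordDist x y = starDist (star x) (star y) + ∣ column x - column y ∣

  Valid : Coord → Set
  Valid x = star x < m × round x < h

  -- 2 + (h + h) is the diameter plus one
  Spaced : Coord → Coord → Set
  Spaced x y = label x + (2 + (h + h)) ≤ label y + coordDist x y

  bonus-mono : ∀ {o o′} → o ≤ o′ → bonus o ≤ bonus o′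
  bonus-mono o≤o′ = +-mono-≤ (⊓-monoʳ-≤ 1 o≤o′) (⊓-monoʳ-≤ 1 (∸-monoˡ-≤ (2 * (3 + r)) o≤o′))

  bonus≤2 : ∀ o → bonus o ≤ 2
  bonus≤2 o = +-mono-≤ (m⊓n≤m 1 o) (m⊓n≤m 1 _)

  1⊓2*a≡depth : ∀ a → 1 ⊓ (2 * a) ≡ depth a
  1⊓2*a≡depth zero    = refl
  1⊓2*a≡depth (suc a) = refl

  bonus-upper : ∀ {a} → a < m → bonus (2 * a) ≡ depth a
  bonus-upper {a} a<m = begin
    1 ⊓ (2 * a) + 1 ⊓ (2 * a ∸ 2 * (3 + r))
      ≡⟨ cong (λ k → 1 ⊓ (2 * a) + 1 ⊓ k) (m≤n⇒m∸n≡0 (*-monoʳ-≤ 2 (s≤s⁻¹ a<m))) ⟩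
    1 ⊓ (2 * a) + 0
      ≡⟨ +-identityʳ _ ⟩
    1 ⊓ (2 * a)
      ≡⟨ 1⊓2*a≡depth a ⟩
    depth a ∎
    where open ≡-Reasoning

  bonus-lower : ∀ {a} → a < m → bonus (suc (2 * lowerRank a)) + depth a ≡ 2
  bonus-lower {zero}  _   = cong (λ k → 1 + 1 ⊓ k + 0) (m+n∸n≡m 1 (2 * (3 + r)))
  bonus-lower {suc a} a<m = cong (λ k → 1 + 1 ⊓ k + 1) (m≤n⇒m∸n≡0 below-top)
    where
    below-top : suc (2 * lowerRank (suc a)) ≤ 2 * (3 + r)
    below-top =
      ≤-trans (n≤1+n _) (≤-trans (≤-reflexive (sym (*-suc 2 _))) (*-monoʳ-≤ 2 (leafRank<3+r a<m)))

  bonus-leaf : ∀ {a} → suc a < m → bonus (suc (2 * lowerRank (suc a))) ≡ 1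
  bonus-leaf a<m = +-cancelʳ-≡ 1 _ 1 (bonus-lower a<m)

  bonus-top : bonus (suc (2 * (3 + r))) ≡ 2
  bonus-top = trans (sym (+-identityʳ _)) (bonus-lower {0} (s≤s z≤n))

  StarStep : ℕ → ℕ → ℕ → ℕ → Set
  StarStep o a o′ b = bonus o + 2 ≤ bonus o′ + starDist a b

  upper→lower : ∀ {a b} → a < m → b < m → lowerRank b ≡ a →
                StarStep (2 * a) a (suc (2 * lowerRank b)) b
  upper→lower {a} {b} a<m b<m rank≡a = ≤-reflexive (begin
    bonus (2 * a) + 2               ≡⟨ cong₂ _+_ (bonus-upper a<m) (sym (bonus-lower b<m)) ⟩
    depth a + (bonus o′ + depth b)  ≡⟨ swap (depth a) (bonus o′) (depth b) ⟩
    bonus o′ + (depth a + depth b)  ≡⟨ cong (bonus o′ +_) (sym (starDist-≢ a≢b)) ⟩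
    bonus o′ + starDist a b         ∎)
    where
    open ≡-Reasoning
    o′ : ℕ
    o′ = suc (2 * lowerRank b)
    a≢b : a ≢ b
    a≢b a≡b = lowerRank-≢ b (trans rank≡a a≡b)
    swap : ∀ a b c → a + (b + c) ≡ b + (a + c)
    swap = solve-∀

  leaf≢1+lowerRank : ∀ (a : ℕ) → suc a ≢ suc (lowerRank (suc a))
  leaf≢1+lowerRank zero    ()
  leaf≢1+lowerRank (suc a) e = 1+n≢n (suc-injective e)

  lower→upper : ∀ {a b} → a < m → b < m → b ≡ suc (lowerRank a) →
                StarStep (suc (2 * lowerRank a)) a (2 * b) b
  lower→upper {zero}      _   b<m refl = contradiction b<m (<-irrefl refl)
  lower→upper {suc a} {b} a<m b<m refl = ≤-reflexive (begin
    bonus (suc (2 * lowerRank (suc a))) + 2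
      ≡⟨ cong (_+ 2) (bonus-leaf a<m) ⟩
    3
      ≡⟨ cong₂ _+_ (sym (bonus-upper b<m)) (sym (starDist-≢ (leaf≢1+lowerRank a))) ⟩
    bonus (2 * b) + starDist (suc a) b ∎)
    where open ≡-Reasoning

  upper→upper : ∀ {a b} → a < m → b < m → b ≡ suc a → StarStep (2 * a) a (2 * b) b
  upper→upper {a} a<m b<m refl = ≤-reflexive (begin
    bonus (2 * a) + 2
      ≡⟨ cong (_+ 2) (bonus-upper a<m) ⟩
    depth a + 2
      ≡⟨ shift (depth a) ⟩
    1 + (depth a + 1)
      ≡⟨ cong₂ _+_ (sym (bonus-upper b<m)) (sym (starDist-≢ (λ e → 1+n≢n (sym e)))) ⟩
    bonus (2 * suc a) + starDist a (suc a) ∎)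
    where
    open ≡-Reasoning
    shift : ∀ d → d + 2 ≡ 1 + (d + 1)
    shift = solve-∀

  lower→lower : ∀ {a b} → a < m → b < m → lowerRank b ≡ suc (lowerRank a) →
                StarStep (suc (2 * lowerRank a)) a (suc (2 * lowerRank b)) b
  lower→lower {zero}      _   b<m e = contradiction (lowerRank<m b<m) (<-irrefl e)
  lower→lower {suc a} {b} a<m b<m e = ≤-reflexive (begin
    bonus (suc (2 * lowerRank (suc a))) + 2  ≡⟨ cong (_+ 2) (bonus-leaf a<m) ⟩
    3                                        ≡⟨ cong (_+ 1) (sym (bonus-lower b<m)) ⟩
    bonus o′ + depth b + 1                   ≡⟨ rearrange (bonus o′) (depth b) ⟩
    bonus o′ + (1 + depth b)                 ≡⟨ cong (bonus o′ +_) (sym (starDist-≢ a≢b)) ⟩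
    bonus o′ + starDist (suc a) b            ∎)
    where
    open ≡-Reasoning
    o′ : ℕ
    o′ = suc (2 * lowerRank b)
    a≢b : suc a ≢ b
    a≢b refl = 1+n≢n (sym e)
    rearrange : ∀ c d → c + d + 1 ≡ c + (1 + d)
    rearrange = solve-∀

  rank<m : ∀ {x} → Valid x → rank (half x) (star x) < m
  rank<m {⟨ a , upper , ℓ ⟩} (a<m , _) = a<m
  rank<m {⟨ a , lower , ℓ ⟩} (a<m , _) = lowerRank<m a<m

  2+2*k≤q : ∀ {k} → k < m → 2 + 2 * k ≤ q
  2+2*k≤q {k} k<m = ≤-trans (≤-reflexive (sym (*-suc 2 k))) (*-monoʳ-≤ 2 k<m)

  offset+1≤q : ∀ {x} → Valid x → offset x + 1 ≤ q
  offset+1≤q {⟨ a , upper , ℓ ⟩} (a<m , _) =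
    ≤-trans (≤-reflexive (+-comm (2 * a) 1)) (≤-trans (n≤1+n _) (2+2*k≤q a<m))
  offset+1≤q {x@(⟨ a , lower , ℓ ⟩)} valid =
    ≤-trans (≤-reflexive (+-comm (offset x) 1)) (2+2*k≤q (rank<m {x} valid))

  label-growth : ∀ {x y k c c′} → position x + k ≤ position y → extra x + c ≤ extra y + c′ →
                 label x + (k * h + c) ≤ label y + c′
  label-growth {x} {y} {k} {c} {c′} position≤ extra≤ = begin
    position x * h + extra x + (k * h + c)  ≡⟨ regroup (position x) k h (extra x) c ⟩
    (position x + k) * h + (extra x + c)    ≤⟨ +-mono-≤ (*-monoˡ-≤ h position≤) extra≤ ⟩
    position y * h + (extra y + c′)         ≡⟨ sym (+-assoc (position y * h) (extra y) c′) ⟩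
    position y * h + extra y + c′           ∎
    where
    open ≤-Reasoning
    regroup : ∀ p k h e c → p * h + e + (k * h + c) ≡ (p + k) * h + (e + c)
    regroup = solve-∀

  sameRound-growth : ∀ {x y k c c′} → round x ≡ round y → offset x + k ≤ offset y →
                     bonus (offset x) + c ≤ bonus (offset y) + c′ → label x + (k * h + c) ≤ label y + c′
  sameRound-growth {x} {y} {k} {c} {c′} ℓ≡ℓ′ o+k≤o′ bonus≤ = label-growth {x} {y} {k} {c} {c′}
    (begin
      q * round x + offset x + k     ≡⟨ +-assoc (q * round x) (offset x) k ⟩
      q * round x + (offset x + k)   ≤⟨ +-mono-≤ (≤-reflexive (cong (q *_) ℓ≡ℓ′)) o+k≤o′ ⟩
      q * round y + offset y         ∎)
    (begin
      3 * round x + bonus (offset x) + c    ≡⟨ +-assoc (3 * round x) _ c ⟩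
      3 * round x + (bonus (offset x) + c)  ≤⟨ +-mono-≤ (≤-reflexive (cong (3 *_) ℓ≡ℓ′)) bonus≤ ⟩
      3 * round y + (bonus (offset y) + c′) ≡⟨ sym (+-assoc (3 * round y) _ c′) ⟩
      3 * round y + bonus (offset y) + c′   ∎)
    where open ≤-Reasoning

  laterRound-position : ∀ {x y k} → round x < round y → offset x + k ≤ q + offset y →
                        position x + k ≤ position y
  laterRound-position {x} {y} {k} ℓ<ℓ′ o+k≤q+o′ = begin
    q * round x + offset x + k    ≡⟨ +-assoc (q * round x) (offset x) k ⟩
    q * round x + (offset x + k)  ≤⟨ +-monoʳ-≤ (q * round x) o+k≤q+o′ ⟩
    q * round x + (q + offset y)  ≡⟨ regroup q (round x) (offset y) ⟩
    q * suc (round x) + offset y  ≤⟨ +-monoˡ-≤ (offset y) (*-monoʳ-≤ q ℓ<ℓ′) ⟩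
    q * round y + offset y        ∎
    where
    open ≤-Reasoning
    regroup : ∀ q ℓ o → q * ℓ + (q + o) ≡ q * (1 + ℓ) + o
    regroup = solve-∀

  laterRound-extra : ∀ {x y} → round x < round y → extra x + 1 ≤ extra y + 0
  laterRound-extra {x} {y} ℓ<ℓ′ = begin
    3 * round x + bonus (offset x) + 1  ≤⟨ +-monoˡ-≤ 1 (+-monoʳ-≤ (3 * round x) (bonus≤2 (offset x))) ⟩
    3 * round x + 2 + 1                 ≡⟨ regroup (round x) ⟩
    3 * suc (round x)                   ≤⟨ *-monoʳ-≤ 3 ℓ<ℓ′ ⟩
    3 * round y                         ≤⟨ m≤m+n (3 * round y) _ ⟩
    3 * round y + bonus (offset y)      ≡⟨ sym (+-identityʳ _) ⟩
    3 * round y + bonus (offset y) + 0  ∎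
    where
    open ≤-Reasoning
    regroup : ∀ ℓ → 3 * ℓ + 2 + 1 ≡ 3 * (1 + ℓ)
    regroup = solve-∀

  growth⇒Spaced : ∀ {x y t t′ e} → label x + t ≤ label y + t′ → 2 + (h + h) + t′ ≤ t + e →
                  e ≤ coordDist x y → Spaced x y
  growth⇒Spaced {x} {y} {t} {t′} {e} growth budget e≤d =
    +-≤-exchange {label x} {label y} {t} {t′} growth (≤-trans budget (+-monoʳ-≤ t e≤d))

  ∣h+ℓ-ℓ∣≡h : ∀ ℓ → ∣ h + ℓ - ℓ ∣ ≡ h
  ∣h+ℓ-ℓ∣≡h ℓ =
    trans (∣-∣-comm (h + ℓ) ℓ) (trans (cong (λ k → ∣ ℓ - k ∣) (+-comm h ℓ)) (∣m-m+n∣≡n ℓ h))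

  adjacent⇒StarStep : ∀ {a s b s′ ℓ} → a < m → b < m →
                      suc (offset ⟨ a , s , ℓ ⟩) ≡ offset ⟨ b , s′ , ℓ ⟩ →
                      StarStep (offset ⟨ a , s , ℓ ⟩) a (offset ⟨ b , s′ , ℓ ⟩) b ×
                      ∣ column ⟨ a , s , ℓ ⟩ - column ⟨ b , s′ , ℓ ⟩ ∣ ≡ h
  adjacent⇒StarStep {a} {s} {b} {s′} {ℓ} a<m b<m adjacent with offsetOf-adjacent {s} {s′} adjacent
  ... | inj₁ (refl , refl , rank≡) = upper→lower a<m b<m rank≡ , ∣h+ℓ-ℓ∣≡h ℓ
  ... | inj₂ (refl , refl , rank≡) =
    lower→upper a<m b<m rank≡ , trans (∣-∣-comm ℓ (h + ℓ)) (∣h+ℓ-ℓ∣≡h ℓ)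

  adjacent⇒Spaced : ∀ {x y} → Valid x → Valid y → round x ≡ round y → suc (offset x) ≡ offset y →
                    Spaced x y
  adjacent⇒Spaced {x@(⟨ a , s , ℓ ⟩)} {y@(⟨ b , s′ , .ℓ ⟩)} (a<m , _) (b<m , _) refl adjacent
    with adjacent⇒StarStep {a} {s} {b} {s′} {ℓ} a<m b<m adjacent
  ... | starStep , ∣column∣≡h = growth⇒Spaced {x} {y}
    (sameRound-growth {x} {y} refl (≤-reflexive (trans (+-comm _ 1) adjacent)) starStep)
    (≤-reflexive (trans (budget h (starDist a b))
                        (cong (λ c → 1 * h + 2 + (starDist a b + c)) (sym ∣column∣≡h))))
    ≤-refl
    where
    budget : ∀ h d → 2 + (h + h) + d ≡ 1 * h + 2 + (d + h)
    budget = solve-∀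

  twoApart⇒StarStep : ∀ {a s b s′ ℓ} → a < m → b < m →
                      suc (suc (offset ⟨ a , s , ℓ ⟩)) ≡ offset ⟨ b , s′ , ℓ ⟩ →
                      StarStep (offset ⟨ a , s , ℓ ⟩) a (offset ⟨ b , s′ , ℓ ⟩) b ×
                      ∣ column ⟨ a , s , ℓ ⟩ - column ⟨ b , s′ , ℓ ⟩ ∣ ≡ 0
  twoApart⇒StarStep {a} {s} {b} {s′} {ℓ} a<m b<m twoApart with offsetOf-twoApart {s} {s′} twoApart
  twoApart⇒StarStep {s = upper} {ℓ = ℓ} a<m b<m _ | refl , rank≡ =
    upper→upper a<m b<m rank≡ , ∣n-n∣≡0 (h + ℓ)
  twoApart⇒StarStep {s = lower} {ℓ = ℓ} a<m b<m _ | refl , rank≡ =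
    lower→lower a<m b<m rank≡ , ∣n-n∣≡0 ℓ

  twoApart⇒Spaced : ∀ {x y} → Valid x → Valid y → round x ≡ round y → suc (suc (offset x)) ≡ offset y →
                    Spaced x y
  twoApart⇒Spaced {x@(⟨ a , s , ℓ ⟩)} {y@(⟨ b , s′ , .ℓ ⟩)} (a<m , _) (b<m , _) refl twoApart
    with twoApart⇒StarStep {a} {s} {b} {s′} {ℓ} a<m b<m twoApart
  ... | starStep , ∣column∣≡0 = growth⇒Spaced {x} {y}
    (sameRound-growth {x} {y} refl (≤-reflexive (trans (+-comm _ 2) twoApart)) starStep)
    (≤-reflexive (trans (budget h (starDist a b))
                        (cong (λ c → 2 * h + 2 + (starDist a b + c)) (sym ∣column∣≡0))))
    ≤-refl
    where
    budget : ∀ h d → 2 + (h + h) + d ≡ 2 * h + 2 + (d + 0)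
    budget = solve-∀

  far⇒Spaced : ∀ {x y} → round x ≡ round y → 3 + offset x ≤ offset y → 1 ≤ coordDist x y → Spaced x y
  far⇒Spaced {x} {y} ℓ≡ℓ′ far d≥1 = growth⇒Spaced {x} {y}
    (sameRound-growth {x} {y} {3} {0} {0} ℓ≡ℓ′ (≤-trans (≤-reflexive (+-comm _ 3)) far)
                      (+-monoˡ-≤ 0 (bonus-mono (≤-trans (m≤n+m _ 3) far))))
    (≤-trans (m≤m+n _ g) (≤-reflexive (budget g)))
    d≥1
    where
    budget : ∀ g → 2 + (suc g + suc g) + 0 + g ≡ 3 * suc g + 0 + 1
    budget = solve-∀

  twoAhead⇒Spaced : ∀ {x y} → round x < round y → offset x + 2 ≤ q + offset y → 1 ≤ coordDist x y →
                    Spaced x y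
  twoAhead⇒Spaced {x} {y} ℓ<ℓ′ o+2≤q+o′ d≥1 = growth⇒Spaced {x} {y}
    (label-growth {x} {y} {2} {1} {0} (laterRound-position {x} {y} ℓ<ℓ′ o+2≤q+o′)
                                      (laterRound-extra {x} {y} ℓ<ℓ′))
    (≤-reflexive (budget h))
    d≥1
    where
    budget : ∀ h → 2 + (h + h) + 0 ≡ 2 * h + 1 + 1
    budget = solve-∀

  laterRound⇒Spaced : ∀ {x y} → Valid x → Valid y → round x < round y → 1 ≤ coordDist x y → Spaced x y
  laterRound⇒Spaced {x@(⟨ a , upper , ℓ ⟩)} {y} (a<m , _) _ ℓ<ℓ′ d≥1 =
    twoAhead⇒Spaced {x} {y} ℓ<ℓ′
      (≤-trans (≤-reflexive (+-comm (2 * a) 2)) (≤-trans (2+2*k≤q a<m) (m≤m+n q _))) d≥1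
  laterRound⇒Spaced {x@(⟨ a , lower , ℓ ⟩)} {y@(⟨ b , lower , ℓ′ ⟩)} vx _ ℓ<ℓ′ d≥1 =
    twoAhead⇒Spaced {x} {y} ℓ<ℓ′
      (≤-trans (≤-reflexive (sym (+-assoc (offset x) 1 1)))
               (≤-trans (+-monoˡ-≤ 1 (offset+1≤q {x} vx)) (+-monoʳ-≤ q (s≤s z≤n)))) d≥1
  laterRound⇒Spaced {x@(⟨ a , lower , ℓ ⟩)} {y@(⟨ b , upper , ℓ′ ⟩)} vx _ ℓ<ℓ′ _ =
    growth⇒Spaced {x} {y} {e = h + 1}
    (label-growth {x} {y} {1} {1} {0}
      (laterRound-position {x} {y} ℓ<ℓ′ (≤-trans (offset+1≤q {x} vx) (m≤m+n q _)))
      (laterRound-extra {x} {y} ℓ<ℓ′))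
    (≤-reflexive (budget h))
    (≤-trans h+1≤∣column∣ (m≤n+m _ (starDist a b)))
    where
    open ≤-Reasoning
    budget : ∀ h → 2 + (h + h) + 0 ≡ 1 * h + 1 + (h + 1)
    budget = solve-∀
    h+1≤∣column∣ : h + 1 ≤ ∣ ℓ - (h + ℓ′) ∣
    h+1≤∣column∣ = +-cancelˡ-≤ ℓ _ _ (begin
      ℓ + (h + 1)           ≡⟨ trans (+-comm ℓ (h + 1)) (+-assoc h 1 ℓ) ⟩
      h + suc ℓ             ≤⟨ +-monoʳ-≤ h ℓ<ℓ′ ⟩
      h + ℓ′                ≤⟨ m≤n+∣n-m∣ (h + ℓ′) ℓ ⟩
      ℓ + ∣ ℓ - (h + ℓ′) ∣  ∎)

  sameRound⇒Spaced : ∀ {x y} → Valid x → Valid y → round x ≡ round y → offset x < offset y →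
                     1 ≤ coordDist x y → Spaced x y
  sameRound⇒Spaced {x} {y} vx vy ℓ≡ℓ′ o<o′ d≥1 with m≤n⇒m<n∨m≡n o<o′
  ... | inj₂ adjacent = adjacent⇒Spaced {x} {y} vx vy ℓ≡ℓ′ adjacent
  ... | inj₁ o+1<o′ with m≤n⇒m<n∨m≡n o+1<o′
  ...   | inj₂ twoApart = twoApart⇒Spaced {x} {y} vx vy ℓ≡ℓ′ twoApart
  ...   | inj₁ far      = far⇒Spaced {x} {y} ℓ≡ℓ′ far d≥1

  round-offset-injective : ∀ {x y} → Valid x → Valid y → round x ≡ round y → offset x ≡ offset y → x ≡ y
  round-offset-injective {⟨ a , s , ℓ ⟩} {⟨ b , s′ , .ℓ ⟩} (a<m , _) (b<m , _) refl o≡o′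
    with offsetOf-injective {s} {s′} o≡o′
  round-offset-injective {⟨ a , upper , ℓ ⟩} _         _         refl _ | refl , refl  = refl
  round-offset-injective {⟨ a , lower , ℓ ⟩} (a<m , _) (b<m , _) refl _ | refl , rank≡ =
    cong (λ c → ⟨ c , lower , ℓ ⟩) (lowerRank-injective a<m b<m rank≡)

  coordDist-comm : ∀ x y → coordDist x y ≡ coordDist y x
  coordDist-comm x y = cong₂ _+_ (starDist-comm (star x) (star y)) (∣-∣-comm (column x) (column y))

  Spaced-either : ∀ {x y} → Valid x → Valid y → x ≢ y → 1 ≤ coordDist x y → Spaced x y ⊎ Spaced y x
  Spaced-either {x} {y} vx vy x≢y d≥1
    with <-cmp (round x) (round y) | ≤-trans d≥1 (≤-reflexive (coordDist-comm x y))
  ... | tri< ℓ<ℓ′ _ _ | _    = inj₁ (laterRound⇒Spaced {x} {y} vx vy ℓ<ℓ′ d≥1)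
  ... | tri> _ _ ℓ>ℓ′ | d′≥1 = inj₂ (laterRound⇒Spaced {y} {x} vy vx ℓ>ℓ′ d′≥1)
  ... | tri≈ _ ℓ≡ℓ′ _ | d′≥1 with <-cmp (offset x) (offset y)
  ...   | tri< o<o′ _ _ = inj₁ (sameRound⇒Spaced {x} {y} vx vy ℓ≡ℓ′ o<o′ d≥1)
  ...   | tri> _ _ o>o′ = inj₂ (sameRound⇒Spaced {y} {x} vy vx (sym ℓ≡ℓ′) o>o′ d′≥1)
  ...   | tri≈ _ o≡o′ _ = contradiction (round-offset-injective {x} {y} vx vy ℓ≡ℓ′ o≡o′) x≢y

  radio-coords : ∀ {x y} → Valid x → Valid y → x ≢ y → 1 ≤ coordDist x y →
                 2 + (h + h) ∸ coordDist x y ≤ ∣ label x - label y ∣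
  radio-coords {x} {y} vx vy x≢y d≥1 with Spaced-either {x} {y} vx vy x≢y d≥1
  ... | inj₁ x-y = m+n≤o+p⇒n∸p≤∣m-o∣ {label x} {2 + (h + h)} {label y} x-y
  ... | inj₂ y-x =
    subst₂ (λ d l → 2 + (h + h) ∸ d ≤ l) (coordDist-comm y x) (∣-∣-comm (label y) (label x))
           (m+n≤o+p⇒n∸p≤∣m-o∣ {label y} {2 + (h + h)} {label x} y-x)

  firstCoord lastCoord : Coord
  firstCoord = ⟨ 0 , upper , 0 ⟩
  lastCoord  = ⟨ 0 , lower , g ⟩

  label-first : label firstCoord ≡ 0
  label-first rewrite *-zeroʳ q = refl

  label-last : label lastCoord ≡ rnValue m g
  label-last = trans (cong (λ b → position lastCoord * h + (3 * g + b)) bonus-top) (closedForm r g)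
    where
    closedForm : ∀ r g → (2 * (4 + r) * g + suc (2 * (3 + r))) * suc g + (3 * g + 2) ≡
                         2 * (4 + r) * suc g * suc g + (g + suc g)
    closedForm = solve-∀

  label≤label-last : ∀ {x} → Valid x → label x ≤ label lastCoord
  label≤label-last {x} vx@(_ , ℓ<h) = begin
    label x                ≡⟨ sym (+-identityʳ (label x)) ⟩
    label x + (0 * h + 0)  ≤⟨ label-growth {x} {lastCoord} {0} {0} {0} position≤ extra≤ ⟩
    label lastCoord + 0    ≡⟨ +-identityʳ (label lastCoord) ⟩
    label lastCoord        ∎
    where
    open ≤-Reasoning
    offset≤top : offset x ≤ suc (2 * (3 + r))
    offset≤top = s≤s⁻¹ (≤-trans (≤-reflexive (+-comm 1 (offset x)))
                                (≤-trans (offset+1≤q {x} vx) (≤-reflexive (*-suc 2 (3 + r)))))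
    position≤ : position x + 0 ≤ position lastCoord
    position≤ = ≤-trans (≤-reflexive (+-identityʳ _)) (+-mono-≤ (*-monoʳ-≤ q (s≤s⁻¹ ℓ<h)) offset≤top)
    extra≤ : extra x + 0 ≤ extra lastCoord + 0
    extra≤ = +-monoˡ-≤ 0 (+-mono-≤ (*-monoʳ-≤ 3 (s≤s⁻¹ ℓ<h))
                                   (≤-trans (bonus≤2 (offset x)) (≤-reflexive (sym bonus-top))))

  coord : V (StackedBook m (h + h)) → Coord
  coord (a , i) =
    [ (λ ℓ → ⟨ toℕ a , lower , toℕ ℓ ⟩) , (λ ℓ → ⟨ toℕ a , upper , toℕ ℓ ⟩) ]′ (splitAt h i)

  coord-valid : ∀ u → Valid (coord u)
  coord-valid (a , i) with splitAt h i
  ... | inj₁ ℓ = toℕ<n a , toℕ<n ℓ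
  ... | inj₂ ℓ = toℕ<n a , toℕ<n ℓ

  star-coord : ∀ u → star (coord u) ≡ toℕ (proj₁ u)
  star-coord (a , i) with splitAt h i
  ... | inj₁ ℓ = refl
  ... | inj₂ ℓ = refl

  column-coord : ∀ u → column (coord u) ≡ toℕ (proj₂ u)
  column-coord (a , i) with splitAt h i | join-splitAt h h i
  ... | inj₁ ℓ | refl = sym (toℕ-↑ˡ ℓ h)
  ... | inj₂ ℓ | refl = sym (toℕ-↑ʳ h ℓ)

  coordDist-coord : ∀ u v → coordDist (coord u) (coord v) ≡ bookDist u v
  coordDist-coord u v =
    cong₂ _+_ (cong₂ starDist (star-coord u) (star-coord v)) (cong₂ ∣_-_∣ (column-coord u) (column-coord v))

  coord-injective : ∀ {u v} → coord u ≡ coord v → u ≡ v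
  coord-injective {a , i} {b , j} e = cong₂ _,_
    (toℕ-injective (trans (sym (star-coord (a , i))) (trans (cong star e) (star-coord (b , j)))))
    (toℕ-injective (trans (sym (column-coord (a , i))) (trans (cong column e) (column-coord (b , j)))))

  labeling : V (StackedBook m (h + h)) → ℕ
  labeling = label ∘ coord

  labeling-radio : RadioLabeling (StackedBook m (h + h)) labeling
  labeling-radio = radioLabeling-intro book-isDistance book-diam labeling λ u v u≢v →
    subst₂ (λ k d → k ∸ d ≤ ∣ labeling u - labeling v ∣) (+-comm 1 (2 + (g + h))) (coordDist-coord u v)
      (radio-coords {coord u} {coord v} (coord-valid u) (coord-valid v) (u≢v ∘ coord-injective)
        (subst (1 ≤_) (sym (coordDist-coord u v)) (n≢0⇒n>0 (u≢v ∘ d≡0⇒≡))))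
    where open IsDistance (book-isDistance {3 + r} {h + h})

  labeling-span : Span (StackedBook m (h + h)) labeling (rnValue m g)
  labeling-span = (lastVertex , firstVertex , cong₂ _∸_ label-lastVertex label-firstVertex) , ≤rnValue
    where
    lastVertex firstVertex : V (StackedBook m (h + h))
    lastVertex  = zero , fromℕ g ↑ˡ h
    firstVertex = zero , h ↑ʳ zero
    label-lastVertex : labeling lastVertex ≡ rnValue m g
    label-lastVertex rewrite splitAt-↑ˡ h (fromℕ g) h | toℕ-fromℕ g = label-last
    label-firstVertex : labeling firstVertex ≡ 0
    label-firstVertex rewrite splitAt-↑ʳ h h zero = label-first
    ≤rnValue : ∀ u v → labeling u ∸ labeling v ≤ rnValue m g
    ≤rnValue u v = ≤-trans (m∸n≤m (labeling u) (labeling v))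
                     (≤-trans (label≤label-last {coord u} (coord-valid u)) (≤-reflexive label-last))

half-of-even : ∀ {n} → 0 < n → n % 2 ≡ 0 → ∃[ g ] n ≡ suc g + suc g
half-of-even {n} 0<n n%2≡0 with n / 2 | m≡m%n+[m/n]*n n 2
... | zero  | n≡ = contradiction (subst (0 <_) (trans n≡ (cong (_+ 0) n%2≡0)) 0<n) λ ()
... | suc g | n≡ = g , (begin
  n                    ≡⟨ n≡ ⟩
  n % 2 + suc g * 2    ≡⟨ cong (_+ suc g * 2) n%2≡0 ⟩
  suc g * 2            ≡⟨ *-comm (suc g) 2 ⟩
  suc g + (suc g + 0)  ≡⟨ cong (suc g +_) (+-identityʳ (suc g)) ⟩
  suc g + suc g        ∎)
  where open ≡-Reasoning

rnValue-formula : ∀ m g → let n = suc g + suc g in (m * n * n) / 2 + n ∸ 1 ≡ rnValue m g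
rnValue-formula m g = begin
  m * n * n / 2 + n ∸ 1          ≡⟨ cong (λ k → k / 2 + n ∸ 1) (square m g) ⟩
  2 * m * h * h * 2 / 2 + n ∸ 1  ≡⟨ cong (λ k → k + n ∸ 1) (m*n/n≡m (2 * m * h * h) 2) ⟩
  2 * m * h * h + n ∸ 1          ≡⟨ cong (_∸ 1) (+-suc (2 * m * h * h) (g + h)) ⟩
  2 * m * h * h + (g + h)        ∎
  where
  open ≡-Reasoning
  h n : ℕ
  h = suc g
  n = h + h
  square : ∀ m g → m * (suc g + suc g) * (suc g + suc g) ≡ 2 * m * suc g * suc g * 2
  square = solve-∀

theorem3p10 : (m n : ℕ) → 4 ≤ m → 0 < n → n % 2 ≡ 0 →
    RadioNumber (StackedBook m n) ((m * n * n) / 2 + n ∸ 1)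
theorem3p10 m n 4≤m 0<n n%2≡0 with m≤n⇒∃[o]m+o≡n 4≤m | half-of-even 0<n n%2≡0
... | r , refl | g , refl rewrite rnValue-formula (4 + r) g =
  (labeling , labeling-radio , labeling-span) , LowerBound.rnValue≤span (suc r) g
  where open UpperBound r g
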